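{- Let $\mathsf{T}_{\mathsf{f}}$ be any forward trie with $n$ nodes over any alphabet. Then the suffix tree $\mathsf{STree}(\mathsf{T}_{\mathsf{f}})$ has $O(n^2)$ nodes and $O(n^2)$ edges. Moreover, for an alphabet of constant size (at least two characters) or larger, there exist forward tries $\mathsf{T}_{\mathsf{f}}$ with $n$ nodes (for arbitrarily large $n$) for which $\mathsf{STree}(\mathsf{T}_{\mathsf{f}})$ has $\Omega(n^2)$ nodes and $\Omega(n^2)$ edges.
   Context: Let $\Sigma$ be an ordered alphabet. A forward trie $\mathsf{T}_{\mathsf{f}}$ is a rooted tree in which every edge is labeled by a single character of $\Sigma$ and the out-going edges of each node have mutually distinct labels. For nodes $u,v$ of $\mathsf{T}_{\mathsf{f}}$ with $u$ an ancestor of $v$ (possibly $u=v$), $\mathit{str}_{\mathsf{f}}(u,v)$ is the string spelled by the downward path from $u$ to $v$. The set of suffixes of $\mathsf{T}_{\mathsf{f}}$ is $\mathit{Suffix}(\mathsf{T}_{\mathsf{f}})=\{\mathit{str}_{\mathsf{f}}(u,l) : u \text{ a node}, l \text{ a leaf of } \mathsf{T}_{\mathsf{f}}, u \text{ an ancestor of } l\}$. A compact tree for a set $\mathbf{S}$ of strings is a rooted tree whose edges are labeled by non-empty strings, in which every internal node other than possibly the root is branching, the labels of the out-going edges of each node begin with mutually distinct characters, and every string of $\mathbf{S}$ is spelled by a path from the root (possibly ending inside an edge). The suffix tree $\mathsf{STree}(\mathsf{T}_{\mathsf{f}})$ is the compact tree for $\mathit{Suffix}(\mathsf{T}_{\mathsf{f}})$.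 -}

module Defs where

open import Data.Nat using (ℕ; zero; suc; _+_)
open import Data.List using (List; []; _∷_; _++_; map; length)
open import Data.Product using (Σ; ∃; _×_; _,_; proj₁; proj₂)
open import Data.List.Membership.Propositional using (_∈_)
open import Data.List.Relation.Unary.All using (All)
open import Data.List.Relation.Unary.Unique.Propositional using (Unique)
open import Data.Sum using (_⊎_)
open import Data.Bool using (Bool; true; false)
open import Relation.Binary.PropositionalEquality using (_≡_)
open import Data.Nat using (_≤_)

data Trie (A : Set) : Set where
  node : List (A × Trie A) → Trie A

module _ {A : Set} where

  data WFTrie : Trie A → Set where
    wf : ∀ {cs} → Unique (map proj₁ cs) → All (λ e → WFTrie (proj₂ e)) cs →
         WFTrie (node cs)

  mutual
    size : Trie A → ℕ
    size (node cs) = suc (sizes cs)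

    sizes : List (A × Trie A) → ℕ
    sizes [] = 0
    sizes ((_ , t) ∷ cs) = size t + sizes cs

  -- u is a node of t (identified with the subtrie rooted at it)
  data NodeOf (u : Trie A) : Trie A → Set where
    here : NodeOf u u
    down : ∀ {cs a t} → (a , t) ∈ cs → NodeOf u t → NodeOf u (node cs)

  data LeafPath : Trie A → List A → Set where
    leaf : LeafPath (node []) []
    step : ∀ {cs a t w} → (a , t) ∈ cs → LeafPath t w → LeafPath (node cs) (a ∷ w)

  Suffix : Trie A → List A → Set
  Suffix T w = Σ (Trie A) λ u → NodeOf u T × LeafPath u w

-- Compact trees: edges labelled by non-empty strings.  An edge is stored
-- as (a , r , child) with label a ∷ r, so a is its first character.

data CTree (A : Set) : Set where
  cnode : List (A × List A × CTree A) → CTree A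

module _ {A : Set} where

  -- isRoot = true for the root. Non-root internal nodes are branching;
  -- out-going labels begin with mutually distinct characters.
  data WFCTree (isRoot : Bool) : CTree A → Set where
    wfc : ∀ {cs} →
          (isRoot ≡ false → cs ≡ [] ⊎ 2 ≤ length cs) →
          Unique (map proj₁ cs) →
          All (λ e → WFCTree false (proj₂ (proj₂ e))) cs →
          WFCTree isRoot (cnode cs)

  data Spells : CTree A → List A → Set where
    atRoot  : ∀ {t} → Spells t []
    inEdge  : ∀ {cs a r t v s} → (a , r , t) ∈ cs → v ++ s ≡ r →
              Spells (cnode cs) (a ∷ v)
    through : ∀ {cs a r t w} → (a , r , t) ∈ cs → Spells t w →
              Spells (cnode cs) (a ∷ (r ++ w))

  CompactTreeFor : (List A → Set) → CTree A → Set
  CompactTreeFor S C =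
    WFCTree true C ×
    (∀ w → S w → Spells C w) ×
    (∀ w → Spells C w → ∃ λ s → S (w ++ s))

  mutual
    cnodes : CTree A → ℕ
    cnodes (cnode cs) = suc (cnodesL cs)

    cnodesL : List (A × List A × CTree A) → ℕ
    cnodesL [] = 0
    cnodesL ((_ , _ , t) ∷ cs) = cnodes t + cnodesL cs

  mutual
    cedges : CTree A → ℕ
    cedges (cnode cs) = cedgesL cs

    cedgesL : List (A × List A × CTree A) → ℕ
    cedgesL [] = 0
    cedgesL ((_ , _ , t) ∷ cs) = suc (cedges t + cedgesL cs)

  IsSTree : Trie A → CTree A → Set
  IsSTree T C = CompactTreeFor (Suffix T) C

-- Upper bound: distinct nodes of a compact tree spell distinct strings, and every
-- node of STree(T) spells a prefix of a suffix of T, i.e. the string of a downward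
-- path between two nodes of T.  There are at most n² such pairs of nodes (so the
-- bound holds even if sibling edges of T share a label).
--
-- Lower bound: let T be the path a^N followed by the comb b^(N+1) whose nodes all
-- carry an a-leaf, so n = 3(N+1).  Its suffix trie is the path a^(N+1) whose every
-- node also carries the comb b^N; all its internal nodes branch, so it already is
-- STree(T), and it has 2(N+1)² edges.
module Submission where

open import Defs
open import Data.Nat using (ℕ; _≤_; _*_)
open import Data.Product using (Σ; _×_)
open import Relation.Binary.PropositionalEquality using (_≢_)

open import Data.Bool using (false)
open import Data.Empty using (⊥; ⊥-elim)
import Data.Fin as Fin
open import Data.Fin.Properties using (injective⇒≤)
open import Data.List using (List; []; _∷_; _++_; map; length; lookup)
open import Data.List.Membership.Propositional using (_∈_)
open import Data.List.Membership.Propositional.Properties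
  using (∈-lookup; ∈-++⁺ˡ; ∈-++⁺ʳ; ∈-++⁻; ∈-map⁺; ∈-map⁻)
import Data.List.Membership.Setoid.Properties as SetoidMembership
open import Data.List.Properties
  using (length-++; length-map; ++-cancelˡ; ++-conicalˡ; ∷-injectiveˡ)
open import Data.List.Relation.Binary.Subset.Propositional using (_⊆_)
open import Data.List.Relation.Unary.All as All using (All; []; _∷_)
open import Data.List.Relation.Unary.AllPairs using ([]; _∷_)
import Data.List.Relation.Unary.Any as Any
open import Data.List.Relation.Unary.Any using (here; there)
open import Data.List.Relation.Unary.Unique.Propositional using (Unique)
import Data.List.Relation.Unary.Unique.Propositional.Properties as Unique
open import Data.Nat using (zero; suc; _+_; z≤n; s≤s; _≤′_; ≤′-refl; ≤′-step)
open import Data.Nat.Properties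
open import Data.Nat.Tactic.RingSolver using (solve-∀)
open import Data.Product using (∃; _,_; proj₁; proj₂; map₂)
open import Data.Sum using (_⊎_; inj₁; inj₂; map₁)
open import Relation.Binary.PropositionalEquality
  using (_≡_; refl; sym; trans; cong; cong₂; setoid)

module _ {B : Set} where

  lookup-injective : ∀ {xs : List B} → Unique xs →
                     ∀ i j → lookup xs i ≡ lookup xs j → i ≡ j
  lookup-injective {_ ∷ _} _ Fin.zero    Fin.zero    _  = refl
  lookup-injective (x∉xs ∷ _)   Fin.zero    (Fin.suc j) eq = ⊥-elim (All.lookup x∉xs (∈-lookup j) eq)
  lookup-injective (x∉xs ∷ _)   (Fin.suc i) Fin.zero    eq = ⊥-elim (All.lookup x∉xs (∈-lookup i) (sym eq))
  lookup-injective (_ ∷ unique) (Fin.suc i) (Fin.suc j) eq = cong Fin.suc (lookup-injective unique i j eq)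

  unique-⊆⇒length-≤ : ∀ {xs ys : List B} → Unique xs → xs ⊆ ys → length xs ≤ length ys
  unique-⊆⇒length-≤ {xs} {ys} unique xs⊆ys = injective⇒≤ {f = position} position-injective
    where
    position : Fin.Fin (length xs) → Fin.Fin (length ys)
    position i = Any.index (xs⊆ys (∈-lookup i))

    position-injective : ∀ {i j} → position i ≡ position j → i ≡ j
    position-injective {i} {j} eq =
      lookup-injective unique i j (SetoidMembership.index-injective (setoid B) _ _ eq)

m*m+n*n≤[m+n]*[m+n] : ∀ m n → m * m + n * n ≤ (m + n) * (m + n)
m*m+n*n≤[m+n]*[m+n] m n = begin
  m * m + n * n             ≤⟨ +-mono-≤ (*-monoʳ-≤ m (m≤m+n m n)) (*-monoʳ-≤ n (m≤n+m n m)) ⟩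
  m * (m + n) + n * (m + n) ≡⟨ *-distribʳ-+ (m + n) m n ⟨
  (m + n) * (m + n)         ∎
  where open ≤-Reasoning

module _ {A : Set} where

  mutual
    nodeStrings : CTree A → List (List A)
    nodeStrings (cnode cs) = [] ∷ nodeStringsL cs

    nodeStringsL : List (A × List A × CTree A) → List (List A)
    nodeStringsL [] = []
    nodeStringsL ((a , r , t) ∷ cs) = map ((a ∷ r) ++_) (nodeStrings t) ++ nodeStringsL cs

  mutual
    length-nodeStrings : (C : CTree A) → length (nodeStrings C) ≡ cnodes C
    length-nodeStrings (cnode cs) = cong suc (length-nodeStringsL cs)

    length-nodeStringsL : (cs : List (A × List A × CTree A)) → length (nodeStringsL cs) ≡ cnodesL cs
    length-nodeStringsL [] = refl
    length-nodeStringsL ((a , r , t) ∷ cs) =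
      trans (length-++ (map ((a ∷ r) ++_) (nodeStrings t)))
            (cong₂ _+_ (trans (length-map _ (nodeStrings t)) (length-nodeStrings t))
                       (length-nodeStringsL cs))

  mutual
    cnodes≡1+cedges : (C : CTree A) → cnodes C ≡ suc (cedges C)
    cnodes≡1+cedges (cnode cs) = cong suc (cnodesL≡cedgesL cs)

    cnodesL≡cedgesL : (cs : List (A × List A × CTree A)) → cnodesL cs ≡ cedgesL cs
    cnodesL≡cedgesL [] = refl
    cnodesL≡cedgesL ((a , r , t) ∷ cs) = cong₂ _+_ (cnodes≡1+cedges t) (cnodesL≡cedgesL cs)

  cedges≤cnodes : (C : CTree A) → cedges C ≤ cnodes C
  cedges≤cnodes C = ≤-trans (n≤1+n (cedges C)) (≤-reflexive (sym (cnodes≡1+cedges C)))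

  nodeStringsL-head : ∀ {z} cs → z ∈ nodeStringsL cs →
                      ∃ λ c → c ∈ map proj₁ cs × ∃ λ z′ → z ≡ c ∷ z′
  nodeStringsL-head ((a , r , t) ∷ cs) z∈ with ∈-++⁻ (map ((a ∷ r) ++_) (nodeStrings t)) z∈
  ... | inj₁ z∈t with ∈-map⁻ ((a ∷ r) ++_) z∈t
  ...   | w , _ , z≡ar++w = a , here refl , r ++ w , z≡ar++w
  nodeStringsL-head ((a , r , t) ∷ cs) z∈ | inj₂ z∈cs =
    let c , c∈cs , z′ , z≡c∷z′ = nodeStringsL-head cs z∈cs in c , there c∈cs , z′ , z≡c∷z′

  mutual
    nodeStrings-unique : ∀ {b} C → WFCTree b C → Unique (nodeStrings C)
    nodeStrings-unique (cnode cs) (wfc _ labels-unique children-wf) =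
      All.tabulate root∉ ∷ nodeStringsL-unique cs labels-unique children-wf
      where
      root∉ : ∀ {z} → z ∈ nodeStringsL cs → [] ≢ z
      root∉ z∈ with nodeStringsL-head cs z∈
      ... | _ , _ , _ , refl = λ ()

    nodeStringsL-unique : ∀ cs → Unique (map proj₁ cs) →
                          All (λ e → WFCTree false (proj₂ (proj₂ e))) cs →
                          Unique (nodeStringsL cs)
    nodeStringsL-unique [] _ _ = []
    nodeStringsL-unique ((a , r , t) ∷ cs) (a∉cs ∷ labels-unique) (t-wf ∷ cs-wf) =
      Unique.++⁺ (Unique.map⁺ (++-cancelˡ (a ∷ r) _ _) (nodeStrings-unique t t-wf))
                 (nodeStringsL-unique cs labels-unique cs-wf)
                 disjoint
      where
      disjoint : ∀ {v} → v ∈ map ((a ∷ r) ++_) (nodeStrings t) × v ∈ nodeStringsL cs → ⊥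
      disjoint (v∈t , v∈cs) with ∈-map⁻ ((a ∷ r) ++_) v∈t | nodeStringsL-head cs v∈cs
      ... | _ , _ , refl | c , c∈cs , _ , a∷rw≡c∷z′ = All.lookup a∉cs c∈cs (∷-injectiveˡ a∷rw≡c∷z′)

  mutual
    nodeStrings-spelled : ∀ {w} C → w ∈ nodeStrings C → Spells C w
    nodeStrings-spelled (cnode cs) (here refl) = atRoot
    nodeStrings-spelled (cnode cs) (there w∈) = nodeStringsL-spelled cs (λ e∈ → e∈) w∈

    nodeStringsL-spelled : ∀ {w ds} cs → cs ⊆ ds → w ∈ nodeStringsL cs → Spells (cnode ds) w
    nodeStringsL-spelled ((a , r , t) ∷ cs) cs⊆ds w∈ with ∈-++⁻ (map ((a ∷ r) ++_) (nodeStrings t)) w∈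
    ... | inj₁ w∈t with ∈-map⁻ ((a ∷ r) ++_) w∈t
    ...   | _ , w′∈t , refl = through (cs⊆ds (here refl)) (nodeStrings-spelled t w′∈t)
    nodeStringsL-spelled ((a , r , t) ∷ cs) cs⊆ds w∈ | inj₂ w∈cs =
      nodeStringsL-spelled cs (λ e∈ → cs⊆ds (there e∈)) w∈cs

  mutual
    paths : Trie A → List (List A)
    paths (node cs) = [] ∷ pathsL cs

    pathsL : List (A × Trie A) → List (List A)
    pathsL [] = []
    pathsL ((a , t) ∷ cs) = map (a ∷_) (paths t) ++ pathsL cs

  mutual
    length-paths : (t : Trie A) → length (paths t) ≡ size t
    length-paths (node cs) = cong suc (length-pathsL cs)

    length-pathsL : (cs : List (A × Trie A)) → length (pathsL cs) ≡ sizes cs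
    length-pathsL [] = refl
    length-pathsL ((a , t) ∷ cs) =
      trans (length-++ (map (a ∷_) (paths t)))
            (cong₂ _+_ (trans (length-map _ (paths t)) (length-paths t)) (length-pathsL cs))

  ∈-pathsL : ∀ {a t w} cs → (a , t) ∈ cs → w ∈ paths t → a ∷ w ∈ pathsL cs
  ∈-pathsL ((a , t) ∷ cs) (here refl) w∈ = ∈-++⁺ˡ (∈-map⁺ (a ∷_) w∈)
  ∈-pathsL ((a , t) ∷ cs) (there e∈) w∈ = ∈-++⁺ʳ (map (a ∷_) (paths t)) (∈-pathsL cs e∈ w∈)

  leafPath-prefix∈paths : ∀ {u} w {s} → LeafPath u (w ++ s) → w ∈ paths u
  leafPath-prefix∈paths {node cs} [] _ = here refl
  leafPath-prefix∈paths {node cs} (c ∷ w) (step e∈ lp) = there (∈-pathsL cs e∈ (leafPath-prefix∈paths w lp))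

  -- substrings T lists str(u, v) for every ancestor u of every node v, with repetitions.
  mutual
    substrings : Trie A → List (List A)
    substrings (node cs) = paths (node cs) ++ substringsL cs

    substringsL : List (A × Trie A) → List (List A)
    substringsL [] = []
    substringsL ((a , t) ∷ cs) = substrings t ++ substringsL cs

  ∈-substringsL : ∀ {a t w} cs → (a , t) ∈ cs → w ∈ substrings t → w ∈ substringsL cs
  ∈-substringsL ((a , t) ∷ cs) (here refl) w∈ = ∈-++⁺ˡ w∈
  ∈-substringsL ((a , t) ∷ cs) (there e∈) w∈ = ∈-++⁺ʳ (substrings t) (∈-substringsL cs e∈ w∈)

  nodeOf⇒paths⊆substrings : ∀ {u T} → NodeOf u T → paths u ⊆ substrings T
  nodeOf⇒paths⊆substrings {T = node cs} here w∈ = ∈-++⁺ˡ w∈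
  nodeOf⇒paths⊆substrings {T = node cs} (down e∈ u∈t) w∈ =
    ∈-++⁺ʳ (paths (node cs)) (∈-substringsL cs e∈ (nodeOf⇒paths⊆substrings u∈t w∈))

  mutual
    length-substrings : (t : Trie A) → length (substrings t) ≤ size t * size t
    length-substrings (node cs) = begin
      length (paths (node cs) ++ substringsL cs)         ≡⟨ length-++ (paths (node cs)) ⟩
      length (paths (node cs)) + length (substringsL cs) ≡⟨ cong (_+ length (substringsL cs)) (length-paths (node cs)) ⟩
      suc n + length (substringsL cs)                    ≤⟨ +-monoʳ-≤ (suc n) (length-substringsL cs) ⟩
      suc n + n * n                                      ≤⟨ +-monoʳ-≤ (suc n) (*-monoʳ-≤ n (n≤1+n n)) ⟩
      suc n * suc n                                      ∎
      where
      open ≤-Reasoning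
      n = sizes cs

    length-substringsL : (cs : List (A × Trie A)) → length (substringsL cs) ≤ sizes cs * sizes cs
    length-substringsL [] = z≤n
    length-substringsL ((a , t) ∷ cs) = begin
      length (substrings t ++ substringsL cs)            ≡⟨ length-++ (substrings t) ⟩
      length (substrings t) + length (substringsL cs)    ≤⟨ +-mono-≤ (length-substrings t) (length-substringsL cs) ⟩
      size t * size t + sizes cs * sizes cs              ≤⟨ m*m+n*n≤[m+n]*[m+n] (size t) (sizes cs) ⟩
      (size t + sizes cs) * (size t + sizes cs)          ∎
      where open ≤-Reasoning

  STree-cnodes-≤ : ∀ {T C} → IsSTree T C → cnodes C ≤ size T * size T
  STree-cnodes-≤ {T} {C} (C-wf , _ , spelled⇒prefix) = begin
    cnodes C               ≡⟨ length-nodeStrings C ⟨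
    length (nodeStrings C) ≤⟨ unique-⊆⇒length-≤ (nodeStrings-unique C C-wf) nodeStrings⊆substrings ⟩
    length (substrings T)  ≤⟨ length-substrings T ⟩
    size T * size T        ∎
    where
    open ≤-Reasoning
    nodeStrings⊆substrings : nodeStrings C ⊆ substrings T
    nodeStrings⊆substrings {z} z∈ with spelled⇒prefix z (nodeStrings-spelled C z∈)
    ... | _ , _ , u∈T , lp = nodeOf⇒paths⊆substrings u∈T (leafPath-prefix∈paths z lp)

  STree-cedges-≤ : ∀ {T C} → IsSTree T C → cedges C ≤ size T * size T
  STree-cedges-≤ {T} {C} isSTree = ≤-trans (cedges≤cnodes C) (STree-cnodes-≤ {T} isSTree)

  _⊑_ : CTree A → CTree A → Set
  C ⊑ D = ∀ {w} → Spells C w → Spells D w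

  cnode-⊑ : ∀ {cs ds} →
            (∀ {a r t} → (a , r , t) ∈ cs → ∃ λ t′ → (a , r , t′) ∈ ds × t ⊑ t′) →
            cnode cs ⊑ cnode ds
  cnode-⊑ edge atRoot = atRoot
  cnode-⊑ edge (inEdge e∈ v++s≡r) = let _ , e′∈ , _ = edge e∈ in inEdge e′∈ v++s≡r
  cnode-⊑ edge (through e∈ sp) = let _ , e′∈ , t⊑t′ = edge e∈ in through e′∈ (t⊑t′ sp)

  empty-⊑ : ∀ {C} → cnode [] ⊑ C
  empty-⊑ atRoot = atRoot
  empty-⊑ (inEdge () _)
  empty-⊑ (through () _)

  ⊑-chain : (f : ℕ → CTree A) → (∀ n → f n ⊑ f (suc n)) → ∀ {m n} → m ≤′ n → f m ⊑ f n
  ⊑-chain f ⊑-suc ≤′-refl = λ sp → sp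
  ⊑-chain f ⊑-suc {n = suc n} (≤′-step m≤n) = λ sp → ⊑-suc n (⊑-chain f ⊑-suc m≤n sp)

module Broom {A : Set} (a b : A) (N : ℕ) where

  fork : Trie A → Trie A → Trie A
  fork x y = node ((a , x) ∷ (b , y) ∷ [])

  comb : ℕ → Trie A
  comb zero = node []
  comb (suc q) = fork (node []) (comb q)

  broom : ℕ → Trie A
  broom zero = comb (suc N)
  broom (suc p) = node ((a , broom p) ∷ [])

  cfork : CTree A → CTree A → CTree A
  cfork x y = cnode ((a , [] , x) ∷ (b , [] , y) ∷ [])

  ccomb : ℕ → CTree A
  ccomb zero = cnode []
  ccomb (suc q) = cfork (cnode []) (ccomb q)

  cbroom : ℕ → CTree A
  cbroom zero = ccomb (suc N)
  cbroom (suc r) = cfork (cbroom r) (ccomb N)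

  wf-fork : ∀ {x y} → a ≢ b → WFTrie x → WFTrie y → WFTrie (fork x y)
  wf-fork a≢b x-wf y-wf = wf ((a≢b ∷ []) ∷ [] ∷ []) (x-wf ∷ y-wf ∷ [])

  wf-comb : a ≢ b → ∀ q → WFTrie (comb q)
  wf-comb a≢b zero = wf [] []
  wf-comb a≢b (suc q) = wf-fork a≢b (wf [] []) (wf-comb a≢b q)

  wf-broom : a ≢ b → ∀ p → WFTrie (broom p)
  wf-broom a≢b zero = wf-comb a≢b (suc N)
  wf-broom a≢b (suc p) = wf ([] ∷ []) (wf-broom a≢b p ∷ [])

  wf-cfork : ∀ {root x y} → a ≢ b → WFCTree false x → WFCTree false y → WFCTree root (cfork x y)
  wf-cfork a≢b x-wf y-wf = wfc (λ _ → inj₂ (s≤s (s≤s z≤n))) ((a≢b ∷ []) ∷ [] ∷ []) (x-wf ∷ y-wf ∷ [])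

  wf-ccomb : ∀ {root} → a ≢ b → ∀ q → WFCTree root (ccomb q)
  wf-ccomb a≢b zero = wfc (λ _ → inj₁ refl) [] []
  wf-ccomb a≢b (suc q) = wf-cfork a≢b (wf-ccomb a≢b 0) (wf-ccomb a≢b q)

  wf-cbroom : ∀ {root} → a ≢ b → ∀ r → WFCTree root (cbroom r)
  wf-cbroom a≢b zero = wf-ccomb a≢b (suc N)
  wf-cbroom a≢b (suc r) = wf-cfork a≢b (wf-cbroom a≢b r) (wf-ccomb a≢b N)

  cfork-⊑ : ∀ {x x′ y y′} → x ⊑ x′ → y ⊑ y′ → cfork x y ⊑ cfork x′ y′
  cfork-⊑ x⊑x′ y⊑y′ = cnode-⊑ λ
    { (here refl)         → _ , here refl , x⊑x′
    ; (there (here refl)) → _ , there (here refl) , y⊑y′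
    ; (there (there ())) }

  ccomb-⊑-suc : ∀ q → ccomb q ⊑ ccomb (suc q)
  ccomb-⊑-suc zero = empty-⊑
  ccomb-⊑-suc (suc q) = cfork-⊑ (λ sp → sp) (ccomb-⊑-suc q)

  cbroom-⊑-suc : ∀ r → cbroom r ⊑ cbroom (suc r)
  cbroom-⊑-suc zero = cfork-⊑ empty-⊑ (λ sp → sp)
  cbroom-⊑-suc (suc r) = cfork-⊑ (cbroom-⊑-suc r) (λ sp → sp)

  ccomb-mono : ∀ {q q′} → q ≤′ q′ → ccomb q ⊑ ccomb q′
  ccomb-mono = ⊑-chain ccomb ccomb-⊑-suc

  cbroom-mono : ∀ {r r′} → r ≤′ r′ → cbroom r ⊑ cbroom r′
  cbroom-mono = ⊑-chain cbroom cbroom-⊑-suc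

  data ForkSpelling (x y : CTree A) : List A → Set where
    root  : ForkSpelling x y []
    left  : ∀ {v} → Spells x v → ForkSpelling x y (a ∷ v)
    right : ∀ {v} → Spells y v → ForkSpelling x y (b ∷ v)

  cfork-spells⁻ : ∀ {x y w} → Spells (cfork x y) w → ForkSpelling x y w
  cfork-spells⁻ atRoot = root
  cfork-spells⁻ (inEdge {v = v} {s} (here refl) v++s≡[]) with ++-conicalˡ v s v++s≡[]
  ... | refl = left atRoot
  cfork-spells⁻ (inEdge {v = v} {s} (there (here refl)) v++s≡[]) with ++-conicalˡ v s v++s≡[]
  ... | refl = right atRoot
  cfork-spells⁻ (inEdge (there (there ())) _)
  cfork-spells⁻ (through (here refl) sp) = left sp
  cfork-spells⁻ (through (there (here refl)) sp) = right sp
  cfork-spells⁻ (through (there (there ())) _)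

  comb-leafPath-spelled : ∀ q {w} → LeafPath (comb q) w → Spells (ccomb q) w
  comb-leafPath-spelled zero leaf = atRoot
  comb-leafPath-spelled (suc q) (step (here refl) lp) = through (here refl) (comb-leafPath-spelled 0 lp)
  comb-leafPath-spelled (suc q) (step (there (here refl)) lp) = through (there (here refl)) (comb-leafPath-spelled q lp)
  comb-leafPath-spelled (suc q) (step (there (there ())) _)

  broom-leafPath-spelled : ∀ p {w} → LeafPath (broom p) w → Spells (cbroom p) w
  broom-leafPath-spelled zero lp = comb-leafPath-spelled (suc N) lp
  broom-leafPath-spelled (suc p) (step (here refl) lp) = through (here refl) (broom-leafPath-spelled p lp)
  broom-leafPath-spelled (suc p) (step (there ()) _)

  nodeOf-comb : ∀ {u} q → NodeOf u (comb q) → ∃ λ q′ → q′ ≤′ q × u ≡ comb q′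
  nodeOf-comb zero here = 0 , ≤′-refl , refl
  nodeOf-comb (suc q) here = suc q , ≤′-refl , refl
  nodeOf-comb (suc q) (down (here refl) here) = 0 , z≤′n , refl
  nodeOf-comb (suc q) (down (there (here refl)) u∈) =
    let q′ , q′≤q , u≡ = nodeOf-comb q u∈ in q′ , ≤′-step q′≤q , u≡
  nodeOf-comb (suc q) (down (there (there ())) _)

  nodeOf-broom : ∀ {u} p → NodeOf u (broom p) →
                 (∃ λ i → i ≤′ p × u ≡ broom i) ⊎ (∃ λ q → q ≤′ suc N × u ≡ comb q)
  nodeOf-broom zero u∈ = inj₂ (nodeOf-comb (suc N) u∈)
  nodeOf-broom (suc p) here = inj₁ (suc p , ≤′-refl , refl)
  nodeOf-broom (suc p) (down (here refl) u∈) =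
    map₁ (λ (i , i≤p , u≡) → i , ≤′-step i≤p , u≡) (nodeOf-broom p u∈)
  nodeOf-broom (suc p) (down (there ()) _)

  broom-nodeOf-broom : ∀ {i p} → i ≤′ p → NodeOf (broom i) (broom p)
  broom-nodeOf-broom ≤′-refl = here
  broom-nodeOf-broom (≤′-step i≤p) = down (here refl) (broom-nodeOf-broom i≤p)

  suffix-spelled : ∀ m {w} → Suffix (broom m) w → Spells (cbroom m) w
  suffix-spelled m (u , u∈ , lp) with nodeOf-broom m u∈
  ... | inj₁ (i , i≤m , refl) = cbroom-mono i≤m (broom-leafPath-spelled i lp)
  ... | inj₂ (q , q≤1+N , refl) = cbroom-mono (z≤′n {m}) (ccomb-mono q≤1+N (comb-leafPath-spelled q lp))

  ccomb-spelled-extends : ∀ q {w} → Spells (ccomb q) w → ∃ λ s → LeafPath (comb q) (w ++ s)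
  ccomb-spelled-extends zero atRoot = [] , leaf
  ccomb-spelled-extends (suc q) sp with cfork-spells⁻ sp
  ... | root     = a ∷ [] , step (here refl) leaf
  ... | left sx  = map₂ (step (here refl)) (ccomb-spelled-extends 0 sx)
  ... | right sy = map₂ (step (there (here refl))) (ccomb-spelled-extends q sy)

  cbroom-spelled-extends : ∀ r {w} → Spells (cbroom r) w →
                           ∃ λ i → i ≤′ r × ∃ λ s → LeafPath (broom i) (w ++ s)
  cbroom-spelled-extends zero sp = 0 , ≤′-refl , ccomb-spelled-extends (suc N) sp
  cbroom-spelled-extends (suc r) sp with cfork-spells⁻ sp
  ... | root     = 0 , z≤′n , ccomb-spelled-extends (suc N) atRoot
  ... | left sx  = let i , i≤r , s , lp = cbroom-spelled-extends r sx
                   in suc i , s≤′s i≤r , s , step (here refl) lp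
  ... | right sy = 0 , z≤′n , map₂ (step (there (here refl))) (ccomb-spelled-extends N sy)

  broom-STree : a ≢ b → ∀ m → IsSTree (broom m) (cbroom m)
  broom-STree a≢b m = wf-cbroom a≢b m , (λ _ → suffix-spelled m) , λ _ sp →
    let i , i≤m , s , lp = cbroom-spelled-extends m sp
    in s , broom i , broom-nodeOf-broom i≤m , lp

  size-comb : ∀ q → size (comb q) ≡ suc (2 * q)
  size-comb zero = refl
  size-comb (suc q) = trans (cong (λ n → 2 + (n + 0)) (size-comb q)) (arithmetic q)
    where
    arithmetic : ∀ q → 2 + (suc (2 * q) + 0) ≡ suc (2 * suc q)
    arithmetic = solve-∀

  size-broom : ∀ p → size (broom p) ≡ p + size (comb (suc N))
  size-broom zero = refl
  size-broom (suc p) = cong suc (trans (+-identityʳ (size (broom p))) (size-broom p))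

  cedges-ccomb : ∀ q → cedges (ccomb q) ≡ 2 * q
  cedges-ccomb zero = refl
  cedges-ccomb (suc q) = trans (cong (λ n → 2 + (n + 0)) (cedges-ccomb q)) (arithmetic q)
    where
    arithmetic : ∀ q → 2 + (2 * q + 0) ≡ 2 * suc q
    arithmetic = solve-∀

  cedges-cbroom : ∀ r → cedges (cbroom r) ≡ suc r * (2 * suc N)
  cedges-cbroom zero = trans (cedges-ccomb (suc N)) (sym (*-identityˡ _))
  cedges-cbroom (suc r) =
    trans (cong₂ (λ m n → suc (m + suc (n + 0))) (cedges-cbroom r) (cedges-ccomb N)) (arithmetic r N)
    where
    arithmetic : ∀ r k → suc (suc r * (2 * suc k) + suc (2 * k + 0)) ≡ suc (suc r) * (2 * suc k)
    arithmetic = solve-∀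

  size-broom≡3[1+N] : size (broom N) ≡ 3 * suc N
  size-broom≡3[1+N] = trans (size-broom N) (trans (cong (N +_) (size-comb (suc N))) (arithmetic N))
    where
    arithmetic : ∀ k → k + suc (2 * suc k) ≡ 3 * suc k
    arithmetic = solve-∀

  size-broom²≤5*cedges : size (broom N) * size (broom N) ≤ 5 * cedges (cbroom N)
  size-broom²≤5*cedges = begin
    size (broom N) * size (broom N) ≡⟨ cong₂ _*_ size-broom≡3[1+N] size-broom≡3[1+N] ⟩
    3 * n * (3 * n)                 ≡⟨ [3k]²≡9k² n ⟩
    9 * (n * n)                     ≤⟨ *-monoˡ-≤ (n * n) (n≤1+n 9) ⟩
    10 * (n * n)                    ≡⟨ 10k²≡5[k*2k] n ⟩
    5 * (n * (2 * n))               ≡⟨ cong (5 *_) (cedges-cbroom N) ⟨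
    5 * cedges (cbroom N)           ∎
    where
    open ≤-Reasoning
    n = suc N
    [3k]²≡9k² : ∀ k → 3 * k * (3 * k) ≡ 9 * (k * k)
    [3k]²≡9k² = solve-∀
    10k²≡5[k*2k] : ∀ k → 10 * (k * k) ≡ 5 * (k * (2 * k))
    10k²≡5[k*2k] = solve-∀

theorem1 :
    (Σ ℕ λ c → (A : Set) (T : Trie A) → WFTrie T → (C : CTree A) → IsSTree T C →
      (cnodes C ≤ c * (size T * size T)) × (cedges C ≤ c * (size T * size T)))
    ×
    ((A : Set) (a b : A) → a ≢ b →
      Σ ℕ λ c → (N : ℕ) →
        Σ (Trie A) λ T → WFTrie T × N ≤ size T ×
          Σ (CTree A) λ C → IsSTree T C ×
            (size T * size T ≤ c * cnodes C) × (size T * size T ≤ c * cedges C))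
theorem1 =
    (1 , λ _ _ _ _ isSTree → ≤1* (STree-cnodes-≤ isSTree) , ≤1* (STree-cedges-≤ isSTree))
  , λ _ a b a≢b → 5 , λ N → let open Broom a b N in
      broom N , wf-broom a≢b N , ≤-trans (m≤m+n N _) (≤-reflexive (sym (size-broom N)))
    , cbroom N , broom-STree a≢b N
    , ≤-trans size-broom²≤5*cedges (*-monoʳ-≤ 5 (cedges≤cnodes (cbroom N)))
    , size-broom²≤5*cedges
  where
  ≤1* : ∀ {m n} → m ≤ n → m ≤ 1 * n
  ≤1* m≤n = ≤-trans m≤n (≤-reflexive (sym (*-identityˡ _)))
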